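{- Let $a\ge2$ be an integer and let $P_m(x)=b_0x^m+b_1x^{m-1}+\cdots+b_{m-1}x+b_m$ be a polynomial all of whose coefficients $b_0,\dots,b_m$ are positive integers. Put $c_n=\frac{1}{a^{P_m(n)}}$ for $n\ge1$. Then the series $\sum_{n=1}^{\infty}c_n$ converges to an irrational number if and only if $\lim_{n\to\infty}\frac{c_{n+1}}{c_n}=0$. -}

module Defs where

open import Data.Nat as ℕ using (ℕ; zero; suc; _^_; _≤_; _∸_; z≤n; s≤s)
open import Data.Nat.Properties using (m^n≢0; ≤-trans)
open import Data.Fin using (Fin; toℕ) renaming (zero to fzero; suc to fsuc)
open import Data.Integer using (+_)
open import Data.Rational using (ℚ; _/_; _+_; _-_; _*_; ∣_∣; _<_; 0ℚ)
open import Data.Product using (∃; _×_)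
open import Relation.Nullary using (¬_)

ΣFin : (k : ℕ) → (Fin k → ℕ) → ℕ
ΣFin zero    f = 0
ΣFin (suc k) f = f fzero ℕ.+ ΣFin k (λ i → f (fsuc i))

poly : (m : ℕ) → (Fin (suc m) → ℕ) → ℕ → ℕ
poly m b x = ΣFin (suc m) (λ i → b i ℕ.* (x ^ (m ∸ toℕ i)))

recipPow : (a : ℕ) → 2 ≤ a → ℕ → ℚ
recipPow a h k = _/_ (+ 1) (a ^ k) {{m^n≢0 a k {{ℕ.>-nonZero (≤-trans (s≤s z≤n) h)}}}}

c : (a : ℕ) → 2 ≤ a → (m : ℕ) → (Fin (suc m) → ℕ) → ℕ → ℚ
c a h m b n = recipPow a h (poly m b n)

-- partial sums S_N = c_1 + ... + c_N
partialSum : (ℕ → ℚ) → ℕ → ℚ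
partialSum s zero    = 0ℚ
partialSum s (suc N) = partialSum s N + s (suc N)

-- c_{n+1} / c_n, written out: c_{n+1} * a^(P_m(n))   (since c_n = 1/a^(P_m(n)))
ratio : (a : ℕ) → 2 ≤ a → (m : ℕ) → (Fin (suc m) → ℕ) → ℕ → ℚ
ratio a h m b n = c a h m b (suc n) * ((+ (a ^ poly m b n)) / 1)

ConvergesTo : (ℕ → ℚ) → ℚ → Set
ConvergesTo s L = ∀ (ε : ℚ) → 0ℚ < ε → ∃ λ N → ∀ n → N ≤ n → ∣ s n - L ∣ < ε

-- Cauchy sequence of rationals (= convergent in ℝ)
Cauchy : (ℕ → ℚ) → Set
Cauchy s = ∀ (ε : ℚ) → 0ℚ < ε → ∃ λ N → ∀ p q → N ≤ p → N ≤ q → ∣ s p - s q ∣ < ε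

-- The real number defined by the Cauchy sequence s exists and is irrational:
-- s is Cauchy and does not converge to any rational number.
ConvergesToIrrational : (ℕ → ℚ) → Set
ConvergesToIrrational s = Cauchy s × (∀ (r : ℚ) → ¬ ConvergesTo s r)

module Submission where

open import Data.Nat as ℕ using (ℕ; zero; suc; _^_; z≤n; s≤s)
import Data.Nat.Properties as ℕP
open import Data.Integer as ℤ using (ℤ; +_)
import Data.Integer.Properties as ℤP
open import Data.Rational
open import Data.Rational.Properties
open import Data.Rational.Unnormalised as U using (mkℚᵘ) renaming (_≃_ to _≃ᵘ_)
import Data.Rational.Unnormalised.Properties as UP
open import Data.Rational.Solver
open +-*-Solver using (solve; _:+_; _:*_; _:-_; :-_; _:=_; con)
open import Relation.Binary.PropositionalEquality
open import Data.Product using (∃; _,_; proj₁; proj₂)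
open import Data.Sum using (inj₁; inj₂)
open import Relation.Nullary using (¬_)
open import Data.Empty using (⊥; ⊥-elim)
open import Relation.Binary.Definitions using (tri<; tri≈; tri>)
open import Data.Fin using (Fin; toℕ) renaming (zero to fzero; suc to fsuc)
open import Function.Bundles using (_⇔_; mk⇔)
open import Defs

-- Both sides hold exactly when deg P ≥ 2, so the proof splits on the degree.

-- The integer z as a rational number; Defs writes a^k this way in 'ratio'.
int : ℤ → ℚ
int z = z / 1

nat : ℕ → ℚ
nat n = int (+ n)

-- In the unnormalised rationals, 'int z' is literally z/1; all facts about
-- 'int' are proved by transport along this equivalence.
int-≃ : ∀ z → toℚᵘ (int z) ≃ᵘ mkℚᵘ z 0
int-≃ z = toℚᵘ-fromℚᵘ (mkℚᵘ z 0)

int-+ : ∀ x y → int (x ℤ.+ y) ≡ int x + int y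
int-+ x y = toℚᵘ-injective (begin
    toℚᵘ (int (x ℤ.+ y))            ≈⟨ int-≃ (x ℤ.+ y) ⟩
    mkℚᵘ (x ℤ.+ y) 0                ≈⟨ U.*≡* (cong (ℤ._* + 1) (cong₂ ℤ._+_ (sym (ℤP.*-identityʳ x)) (sym (ℤP.*-identityʳ y)))) ⟩
    mkℚᵘ x 0 U.+ mkℚᵘ y 0           ≈⟨ UP.+-cong (UP.≃-sym (int-≃ x)) (UP.≃-sym (int-≃ y)) ⟩
    toℚᵘ (int x) U.+ toℚᵘ (int y)   ≈⟨ UP.≃-sym (toℚᵘ-homo-+ (int x) (int y)) ⟩
    toℚᵘ (int x + int y)            ∎)
  where open UP.≃-Reasoning

int-* : ∀ x y → int (x ℤ.* y) ≡ int x * int y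
int-* x y = toℚᵘ-injective (begin
    toℚᵘ (int (x ℤ.* y))            ≈⟨ int-≃ (x ℤ.* y) ⟩
    mkℚᵘ x 0 U.* mkℚᵘ y 0           ≈⟨ UP.*-cong (UP.≃-sym (int-≃ x)) (UP.≃-sym (int-≃ y)) ⟩
    toℚᵘ (int x) U.* toℚᵘ (int y)   ≈⟨ UP.≃-sym (toℚᵘ-homo-* (int x) (int y)) ⟩
    toℚᵘ (int x * int y)            ∎)
  where open UP.≃-Reasoning

int-neg : ∀ x → int (ℤ.- x) ≡ - int x
int-neg x = toℚᵘ-injective (begin
    toℚᵘ (int (ℤ.- x))              ≈⟨ int-≃ (ℤ.- x) ⟩
    U.- mkℚᵘ x 0                    ≈⟨ UP.-‿cong (UP.≃-sym (int-≃ x)) ⟩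
    U.- toℚᵘ (int x)                ≈⟨ UP.≃-sym (toℚᵘ-homo‿- (int x)) ⟩
    toℚᵘ (- int x)                  ∎)
  where open UP.≃-Reasoning

int-sub : ∀ x y → int (x ℤ.- y) ≡ int x - int y
int-sub x y = trans (int-+ x (ℤ.- y)) (cong (λ q → int x + q) (int-neg y))

int-≤ : ∀ {x y} → x ℤ.≤ y → int x ≤ int y
int-≤ {x} {y} x≤y = toℚᵘ-cancel-≤ (UP.≤-respˡ-≃ (UP.≃-sym (int-≃ x)) (UP.≤-respʳ-≃ (UP.≃-sym (int-≃ y))
  (U.*≤* (subst₂ ℤ._≤_ (sym (ℤP.*-identityʳ x)) (sym (ℤP.*-identityʳ y)) x≤y))))

int-< : ∀ {x y} → x ℤ.< y → int x < int y
int-< {x} {y} x<y = toℚᵘ-cancel-< (UP.<-respˡ-≃ (UP.≃-sym (int-≃ x)) (UP.<-respʳ-≃ (UP.≃-sym (int-≃ y))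
  (U.*<* (subst₂ ℤ._<_ (sym (ℤP.*-identityʳ x)) (sym (ℤP.*-identityʳ y)) x<y))))

int-<⁻¹ : ∀ {x y} → int x < int y → x ℤ.< y
int-<⁻¹ {x} {y} lt with UP.<-respˡ-≃ (int-≃ x) (UP.<-respʳ-≃ (int-≃ y) (toℚᵘ-mono-< lt))
... | U.*<* p = subst₂ ℤ._<_ (ℤP.*-identityʳ x) (ℤP.*-identityʳ y) p

no-integer-in-unit-interval : ∀ z → 0ℚ < int z → int z < 1ℚ → ⊥
no-integer-in-unit-interval z 0<z z<1 = ℤP.<⇒≱ (int-<⁻¹ {z} {+ 1} z<1) (ℤP.i<j⇒suc[i]≤j (int-<⁻¹ {+ 0} {z} 0<z))

nat-+ : ∀ m n → nat (m ℕ.+ n) ≡ nat m + nat n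
nat-+ m n = trans (cong int (ℤP.pos-+ m n)) (int-+ (+ m) (+ n))

nat-* : ∀ m n → nat (m ℕ.* n) ≡ nat m * nat n
nat-* m n = trans (cong int (ℤP.pos-* m n)) (int-* (+ m) (+ n))

nat-≤ : ∀ {m n} → m ℕ.≤ n → nat m ≤ nat n
nat-≤ m≤n = int-≤ (ℤ.+≤+ m≤n)

nat-< : ∀ {m n} → m ℕ.< n → nat m < nat n
nat-< m<n = int-< (ℤ.+<+ m<n)

nat-nonNeg : ∀ n → NonNegative (nat n)
nat-nonNeg n = nonNegative (nat-≤ (z≤n {n}))

nat-inverse : ∀ n .{{_ : ℕ.NonZero n}} → nat n * (+ 1 / n) ≡ 1ℚ
nat-inverse (suc n) = toℚᵘ-injective (begin
    toℚᵘ (nat (suc n) * (+ 1 / suc n))          ≈⟨ toℚᵘ-homo-* (nat (suc n)) (+ 1 / suc n) ⟩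
    toℚᵘ (nat (suc n)) U.* toℚᵘ (+ 1 / suc n)   ≈⟨ UP.*-cong (int-≃ (+ suc n)) (toℚᵘ-fromℚᵘ (mkℚᵘ (+ 1) n)) ⟩
    mkℚᵘ (+ suc n) 0 U.* mkℚᵘ (+ 1) n           ≈⟨ U.*≡* cross ⟩
    toℚᵘ 1ℚ                                     ∎)
  where
  open UP.≃-Reasoning
  cross : (+ suc n ℤ.* + 1) ℤ.* + 1 ≡ + 1 ℤ.* + (1 ℕ.* suc n)
  cross = trans (ℤP.*-identityʳ _) (trans (ℤP.*-identityʳ _)
            (sym (trans (ℤP.*-identityˡ _) (cong +_ (ℕP.*-identityˡ (suc n))))))

recip-pos : ∀ n .{{_ : ℕ.NonZero n}} → 0ℚ < + 1 / n
recip-pos n = positive⁻¹ (+ 1 / n) {{normalize-pos 1 n}}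

clear-denominator : ∀ p → p * nat (↧ₙ p) ≡ int (↥ p)
clear-denominator p@(mkℚ n d _) = toℚᵘ-injective (begin
    toℚᵘ (p * nat (suc d))              ≈⟨ toℚᵘ-homo-* p (nat (suc d)) ⟩
    toℚᵘ p U.* toℚᵘ (nat (suc d))       ≈⟨ UP.*-congˡ {toℚᵘ p} (int-≃ (+ suc d)) ⟩
    mkℚᵘ n d U.* mkℚᵘ (+ suc d) 0       ≈⟨ U.*≡* (trans (ℤP.*-identityʳ _) (cong (λ k → n ℤ.* + k) (sym (ℕP.*-identityʳ (suc d))))) ⟩
    mkℚᵘ n 0                            ≈⟨ UP.≃-sym (int-≃ n) ⟩
    toℚᵘ (int n)                        ∎)
  where open UP.≃-Reasoning

inverse-unique : ∀ {p x y} → p * x ≡ 1ℚ → p * y ≡ 1ℚ → x ≡ y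
inverse-unique {p} {x} {y} px≡1 py≡1 = begin
    x             ≡⟨ sym (*-identityʳ x) ⟩
    x * 1ℚ        ≡⟨ cong (x *_) (sym py≡1) ⟩
    x * (p * y)   ≡⟨ solve 3 (λ x p y → x :* (p :* y) := (p :* x) :* y) refl x p y ⟩
    (p * x) * y   ≡⟨ cong (_* y) px≡1 ⟩
    1ℚ * y        ≡⟨ *-identityˡ y ⟩
    y             ∎
  where open ≡-Reasoning

sub-<⁻¹ : ∀ {x y} z → x - z < y - z → x < y
sub-<⁻¹ {x} {y} z lt = subst₂ _<_ (cancel x z) (cancel y z) (+-monoˡ-< z lt)
  where
  cancel : ∀ w z → (w - z) + z ≡ w
  cancel = solve 2 (λ w z → (w :- z) :+ z := w) refl

negate-sub : ∀ x y → - (x - y) ≡ y - x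
negate-sub = solve 2 (λ x y → :- (x :- y) := y :- x) refl

<-sub : ∀ {x y} → x < y → 0ℚ < y - x
<-sub {x} {y} lt = subst (_< y - x) (+-inverseʳ x) (+-monoˡ-< (- x) lt)

x≤∣x∣ : ∀ x → x ≤ ∣ x ∣
x≤∣x∣ x with ∣p∣≡p∨∣p∣≡-p x
... | inj₁ ∣x∣≡x  = ≤-reflexive (sym ∣x∣≡x)
... | inj₂ ∣x∣≡-x = ≤-trans x≤0 (0≤∣p∣ x)
  where
  x≤0 : x ≤ 0ℚ
  x≤0 = subst₂ _≤_ (+-identityˡ x) (+-inverseˡ x) (+-monoˡ-≤ x (subst (0ℚ ≤_) ∣x∣≡-x (0≤∣p∣ x)))

∣∣<-intro : ∀ {x ε} → x < ε → - x < ε → ∣ x ∣ < ε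
∣∣<-intro {x} x<ε -x<ε with ∣p∣≡p∨∣p∣≡-p x
... | inj₁ ∣x∣≡x  = subst (_< _) (sym ∣x∣≡x) x<ε
... | inj₂ ∣x∣≡-x = subst (_< _) (sym ∣x∣≡-x) -x<ε

∣∣<-elimˡ : ∀ {x ε} → ∣ x ∣ < ε → x < ε
∣∣<-elimˡ {x} lt = ≤-<-trans (x≤∣x∣ x) lt

∣∣<-elimʳ : ∀ {x ε} → ∣ x ∣ < ε → - x < ε
∣∣<-elimʳ {x} lt = ≤-<-trans (subst (- x ≤_) (∣-p∣≡∣p∣ x) (x≤∣x∣ (- x))) lt

<⇒≱ : ∀ {x y} → x < y → ¬ (y ≤ x)
<⇒≱ x<y y≤x = <-irrefl refl (<-≤-trans x<y y≤x)

interval-close : ∀ {lo hi x y ε} → lo ≤ x → x < hi → lo ≤ y → y < hi → hi - lo ≤ ε →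
                 ∣ x - y ∣ < ε
interval-close {lo} {hi} {x} {y} {ε} lo≤x x<hi lo≤y y<hi len≤ε =
  ∣∣<-intro (gap< x<hi lo≤y) (subst (_< ε) (sym (negate-sub x y)) (gap< y<hi lo≤x))
  where
  gap< : ∀ {p q} → p < hi → lo ≤ q → p - q < ε
  gap< p<hi lo≤q = <-≤-trans (+-mono-<-≤ p<hi (neg-antimono-≤ lo≤q)) len≤ε

limit-≥ : ∀ {s r L} M → ConvergesTo s r → (∀ n → M ℕ.≤ n → L ≤ s n) → L ≤ r
limit-≥ {s} {r} {L} M s→r L≤s with <-cmp r L
... | tri> _ _ L<r = <⇒≤ L<r
... | tri≈ _ r≡L _ = ≤-reflexive (sym r≡L)
... | tri< r<L _ _ with s→r (L - r) (<-sub r<L)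
...   | N , close = ⊥-elim (<⇒≱ (sub-<⁻¹ r (∣∣<-elimˡ (close n (ℕP.m≤m⊔n N M)))) (L≤s n (ℕP.m≤n⊔m N M)))
  where n = N ℕ.⊔ M

limit-≤ : ∀ {s r U} M → ConvergesTo s r → (∀ n → M ℕ.≤ n → s n ≤ U) → r ≤ U
limit-≤ {s} {r} {U} M s→r s≤U with <-cmp r U
... | tri< r<U _ _ = <⇒≤ r<U
... | tri≈ _ r≡U _ = ≤-reflexive r≡U
... | tri> _ _ U<r with s→r (r - U) (<-sub U<r)
...   | N , close = ⊥-elim (<⇒≱ U<sn (s≤U n (ℕP.m≤n⊔m N M)))
  where
  n = N ℕ.⊔ M
  r-sn<r-U : r - s n < r - U
  r-sn<r-U = subst (_< r - U) (negate-sub (s n) r) (∣∣<-elimʳ (close n (ℕP.m≤m⊔n N M)))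
  U<sn : U < s n
  U<sn = sub-<⁻¹ r (subst₂ _<_ (negate-sub r U) (negate-sub r (s n)) (neg-antimono-< r-sn<r-U))

n<2^n : ∀ n → n ℕ.< 2 ^ n
n<2^n zero    = s≤s z≤n
n<2^n (suc n) = begin-strict
    suc n              ≤⟨ n<2^n n ⟩
    2 ^ n              <⟨ ℕP.m<m+n (2 ^ n) (ℕP.m^n>0 2 n) ⟩
    2 ^ n ℕ.+ 2 ^ n    ≡⟨ cong (2 ^ n ℕ.+_) (sym (ℕP.+-identityʳ (2 ^ n))) ⟩
    2 ^ suc n          ∎
  where open ℕP.≤-Reasoning

module Powers (a : ℕ) (h : 2 ℕ.≤ a) where

  instance
    a≢0 : ℕ.NonZero a
    a≢0 = ℕ.>-nonZero (ℕP.≤-trans (s≤s z≤n) h)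

  u : ℕ → ℚ
  u = recipPow a h

  A : ℕ → ℚ
  A k = nat (a ^ k)

  A*u : ∀ k → A k * u k ≡ 1ℚ
  A*u k = nat-inverse (a ^ k) {{ℕP.m^n≢0 a k}}

  u-pos : ∀ k → 0ℚ < u k
  u-pos k = recip-pos (a ^ k) {{ℕP.m^n≢0 a k}}

  u-nonNeg : ∀ k → NonNegative (u k)
  u-nonNeg k = nonNegative (<⇒≤ (u-pos k))

  A-+ : ∀ j k → A (j ℕ.+ k) ≡ A j * A k
  A-+ j k = trans (cong nat (ℕP.^-distribˡ-+-* a j k)) (nat-* (a ^ j) (a ^ k))

  -- a⁻⁽ʲ⁺ᵏ⁾ = a⁻ʲ a⁻ᵏ, since both are inverse to aʲ⁺ᵏ = aʲ aᵏ.
  u-+ : ∀ j k → u (j ℕ.+ k) ≡ u j * u k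
  u-+ j k = inverse-unique {A (j ℕ.+ k)} (A*u (j ℕ.+ k)) (begin
      A (j ℕ.+ k) * (u j * u k)     ≡⟨ cong (_* (u j * u k)) (A-+ j k) ⟩
      (A j * A k) * (u j * u k)     ≡⟨ solve 4 (λ A B x y → (A :* B) :* (x :* y) := (A :* x) :* (B :* y)) refl (A j) (A k) (u j) (u k) ⟩
      (A j * u j) * (A k * u k)     ≡⟨ cong₂ _*_ (A*u j) (A*u k) ⟩
      1ℚ * 1ℚ                       ≡⟨ *-identityˡ 1ℚ ⟩
      1ℚ                            ∎)
    where open ≡-Reasoning

  u≤1 : ∀ k → u k ≤ 1ℚ
  u≤1 k = begin
      u k             ≡⟨ sym (*-identityˡ (u k)) ⟩
      1ℚ * u k        ≤⟨ *-monoʳ-≤-nonNeg (u k) {{u-nonNeg k}} (nat-≤ (ℕP.m^n>0 a k)) ⟩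
      A k * u k       ≡⟨ A*u k ⟩
      1ℚ              ∎
    where open ≤-Reasoning

  u-antitone : ∀ {k j} → k ℕ.≤ j → u j ≤ u k
  u-antitone {k} {j} k≤j = begin
      u j                 ≡⟨ cong u (sym (ℕP.m∸n+n≡m k≤j)) ⟩
      u (j ℕ.∸ k ℕ.+ k)   ≡⟨ u-+ (j ℕ.∸ k) k ⟩
      u (j ℕ.∸ k) * u k   ≤⟨ *-monoʳ-≤-nonNeg (u k) {{u-nonNeg k}} (u≤1 (j ℕ.∸ k)) ⟩
      1ℚ * u k            ≡⟨ *-identityˡ (u k) ⟩
      u k                 ∎
    where open ≤-Reasoning

  u-halves : ∀ k → nat 2 * u (suc k) ≤ u k
  u-halves k = begin
      nat 2 * u (1 ℕ.+ k)    ≡⟨ cong (nat 2 *_) (u-+ 1 k) ⟩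
      nat 2 * (u 1 * u k)    ≡⟨ sym (*-assoc (nat 2) (u 1) (u k)) ⟩
      (nat 2 * u 1) * u k    ≤⟨ *-monoʳ-≤-nonNeg (u k) {{u-nonNeg k}} 2u₁≤1 ⟩
      1ℚ * u k               ≡⟨ *-identityˡ (u k) ⟩
      u k                    ∎
    where
    open ≤-Reasoning
    2u₁≤1 : nat 2 * u 1 ≤ 1ℚ
    2u₁≤1 = ≤-trans (*-monoʳ-≤-nonNeg (u 1) {{u-nonNeg 1}} (nat-≤ (ℕP.≤-trans h (ℕP.≤-reflexive (sym (ℕP.*-identityʳ a))))))
                    (≤-reflexive (A*u 1))

  -- M · a⁻ᵏ < 1 as soon as k ≥ M, because M < 2ᴹ ≤ aᵏ.
  u-small : ∀ M k → M ℕ.≤ k → nat M * u k < 1ℚ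
  u-small M k M≤k = begin-strict
      nat M * u k   <⟨ *-monoˡ-<-pos (u k) {{positive (u-pos k)}} (nat-< M<aᵏ) ⟩
      A k * u k     ≡⟨ A*u k ⟩
      1ℚ            ∎
    where
    open ≤-Reasoning
    M<aᵏ : M ℕ.< a ^ k
    M<aᵏ = ℕP.<-≤-trans (n<2^n M) (ℕP.≤-trans (ℕP.^-monoʳ-≤ 2 M≤k) (ℕP.^-monoˡ-≤ k h))

  -- a⁻ᵏ → 0: write ε = z/q; then a⁻ᵏ q < 1 ≤ z = ε q for k ≥ q.
  u→0 : ∀ ε → 0ℚ < ε → ∀ k → ↧ₙ ε ℕ.≤ k → u k < ε
  u→0 ε@record{} 0<ε k q≤k = *-cancelʳ-<-nonNeg (nat q) {{nat-nonNeg q}} (begin-strict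
      u k * nat q    ≡⟨ *-comm (u k) (nat q) ⟩
      nat q * u k    <⟨ u-small q k q≤k ⟩
      1ℚ             ≤⟨ int-≤ 1≤↥ε ⟩
      int (↥ ε)      ≡⟨ sym (clear-denominator ε) ⟩
      ε * nat q      ∎)
    where
    open ≤-Reasoning
    q = ↧ₙ ε
    1≤↥ε : + 1 ℤ.≤ ↥ ε
    1≤↥ε = ℤP.i<j⇒suc[i]≤j (ℤP.positive⁻¹ (↥ ε) {{positive 0<ε}})

  -- The ratio a⁻ᵠ / a⁻ᵖ of two such powers (q ≥ p), written u q · aᵖ as in Defs.
  u-ratio : ∀ {p q} → p ℕ.≤ q → u q * A p ≡ u (q ℕ.∸ p)
  u-ratio {p} {q} p≤q = begin
      u q * A p                      ≡⟨ cong (λ e → u e * A p) (sym (ℕP.m∸n+n≡m p≤q)) ⟩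
      u (q ℕ.∸ p ℕ.+ p) * A p        ≡⟨ cong (_* A p) (u-+ (q ℕ.∸ p) p) ⟩
      u (q ℕ.∸ p) * u p * A p        ≡⟨ solve 3 (λ x y z → x :* y :* z := x :* (z :* y)) refl (u (q ℕ.∸ p)) (u p) (A p) ⟩
      u (q ℕ.∸ p) * (A p * u p)      ≡⟨ cong (u (q ℕ.∸ p) *_) (A*u p) ⟩
      u (q ℕ.∸ p) * 1ℚ               ≡⟨ *-identityʳ (u (q ℕ.∸ p)) ⟩
      u (q ℕ.∸ p)                    ∎
    where open ≡-Reasoning

increasing-steps : (f : ℕ → ℚ) → (∀ n → f n ≤ f (suc n)) → ∀ {m n} → m ℕ.≤ n → f m ≤ f n
increasing-steps f step m≤n = go (ℕP.≤⇒≤′ m≤n)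
  where
  go : ∀ {m n} → m ℕ.≤′ n → f m ≤ f n
  go ℕ.≤′-refl      = ≤-refl
  go (ℕ.≤′-step m≤n) = ≤-trans (go m≤n) (step _)

decreasing-steps : (f : ℕ → ℚ) → (∀ n → f (suc n) ≤ f n) → ∀ {m n} → m ℕ.≤ n → f n ≤ f m
decreasing-steps f step m≤n = go (ℕP.≤⇒≤′ m≤n)
  where
  go : ∀ {m n} → m ℕ.≤′ n → f n ≤ f m
  go ℕ.≤′-refl      = ≤-refl
  go (ℕ.≤′-step m≤n) = ≤-trans (step _) (go m≤n)

partialSum-mono : ∀ {s} → (∀ n → 0ℚ ≤ s n) → ∀ {m n} → m ℕ.≤ n → partialSum s m ≤ partialSum s n
partialSum-mono {s} s≥0 = increasing-steps (partialSum s) step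
  where
  step : ∀ n → partialSum s n ≤ partialSum s (suc n)
  step n = subst (_≤ partialSum s (suc n)) (+-identityʳ (partialSum s n)) (+-monoʳ-≤ (partialSum s n) (s≥0 (suc n)))

constant-series-not-Cauchy : ∀ {s x} → 0ℚ < x → (∀ n → s (suc n) ≡ x) → ¬ Cauchy (partialSum s)
constant-series-not-Cauchy {s} {x} 0<x s≡x cauchy with cauchy x 0<x
... | N , close = <-irrefl refl (subst (_< x) ∣step∣≡x (close (suc N) N (ℕP.n≤1+n N) ℕP.≤-refl))
  where
  step≡x : partialSum s (suc N) - partialSum s N ≡ x
  step≡x = trans (solve 2 (λ S y → S :+ y :- S := y) refl (partialSum s N) (s (suc N))) (s≡x N)
  ∣step∣≡x : ∣ partialSum s (suc N) - partialSum s N ∣ ≡ x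
  ∣step∣≡x = trans (cong ∣_∣ step≡x) (0≤p⇒∣p∣≡p (<⇒≤ 0<x))

constant-not-to-0 : ∀ {s x} → 0ℚ < x → (∀ n → s n ≡ x) → ¬ ConvergesTo s 0ℚ
constant-not-to-0 {s} {x} 0<x s≡x s→0 with s→0 x 0<x
... | N , close = <-irrefl refl (subst (_< x) ∣sN∣≡x (close N ℕP.≤-refl))
  where
  ∣sN∣≡x : ∣ s N - 0ℚ ∣ ≡ x
  ∣sN∣≡x = trans (cong ∣_∣ (trans (+-identityʳ (s N)) (s≡x N))) (0≤p⇒∣p∣≡p (<⇒≤ 0<x))

module IncreasingExponents (a : ℕ) (h : 2 ℕ.≤ a) (P : ℕ → ℕ) (P-inc : ∀ n → P n ℕ.< P (suc n)) where
  open Powers a h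

  s : ℕ → ℚ
  s n = u (P n)

  S : ℕ → ℚ
  S = partialSum s

  gap : ℕ → ℕ
  gap n = P (suc n) ℕ.∸ P n

  n≤P : ∀ n → n ℕ.≤ P n
  n≤P zero    = z≤n
  n≤P (suc n) = ℕP.≤-trans (s≤s (n≤P n)) (P-inc n)

  S-mono : ∀ {m n} → m ℕ.≤ n → S m ≤ S n
  S-mono = partialSum-mono (λ n → <⇒≤ (u-pos (P n)))

  -- Q N = S N + s N bounds every later partial sum: the tail after N is
  -- dominated by a geometric series of ratio 1/2, since P increases.
  Q : ℕ → ℚ
  Q n = S n + s n

  Q-antitone : ∀ {m n} → m ℕ.≤ n → Q n ≤ Q m
  Q-antitone = decreasing-steps Q step
    where
    step : ∀ n → Q (suc n) ≤ Q n
    step n = begin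
        S n + s (suc n) + s (suc n)      ≡⟨ solve 2 (λ x y → x :+ y :+ y := x :+ con (nat 2) :* y) refl (S n) (s (suc n)) ⟩
        S n + nat 2 * s (suc n)          ≤⟨ +-monoʳ-≤ (S n) (*-monoˡ-≤-nonNeg (nat 2) {{nat-nonNeg 2}} (u-antitone (P-inc n))) ⟩
        S n + nat 2 * u (suc (P n))      ≤⟨ +-monoʳ-≤ (S n) (u-halves (P n)) ⟩
        S n + s n                        ∎
      where open ≤-Reasoning

  S<Q : ∀ {m n} → m ℕ.≤ n → S n < Q m
  S<Q {m} {n} m≤n = <-≤-trans Sₙ<Qₙ (Q-antitone m≤n)
    where
    Sₙ<Qₙ : S n < Q n
    Sₙ<Qₙ = subst (_< Q n) (+-identityʳ (S n)) (+-monoʳ-< (S n) (u-pos (P n)))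

  -- Beyond K all partial sums lie in [S K, Q K), an interval of length
  -- a^(-P(K)) ≤ a^(-K).
  cauchy : Cauchy S
  cauchy ε 0<ε = K , λ p q K≤p K≤q → interval-close (S-mono K≤p) (S<Q K≤p) (S-mono K≤q) (S<Q K≤q) length≤ε
    where
    K = ↧ₙ ε
    length≤ε : Q K - S K ≤ ε
    length≤ε = <⇒≤ (subst (_< ε) (sym (solve 2 (λ x y → x :+ y :- x := y) refl (S K) (s K)))
                                  (u→0 ε 0<ε (P K) (n≤P K)))

  ratio≡ : ∀ n → s (suc n) * A (P n) ≡ u (gap n)
  ratio≡ n = u-ratio (ℕP.<⇒≤ (P-inc n))

  ratio→0 : (∀ K → ∃ λ N → ∀ n → N ℕ.≤ n → K ℕ.≤ gap n) → ConvergesTo (λ n → s (suc n) * A (P n)) 0ℚ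
  ratio→0 gaps→∞ ε 0<ε with gaps→∞ (↧ₙ ε)
  ... | N , large = N , λ n N≤n → subst (_< ε) (sym (∣ratio∣ n)) (u→0 ε 0<ε (gap n) (large n N≤n))
    where
    ∣ratio∣ : ∀ n → ∣ s (suc n) * A (P n) - 0ℚ ∣ ≡ u (gap n)
    ∣ratio∣ n = trans (cong ∣_∣ (trans (+-identityʳ _) (ratio≡ n))) (0≤p⇒∣p∣≡p (<⇒≤ (u-pos (gap n))))

  S-integral : ∀ N → ∃ λ k → S N * A (P N) ≡ nat k
  S-integral zero    = 0 , *-zeroˡ (A (P 0))
  S-integral (suc N) with S-integral N
  ... | k , Sₙaᴾ≡k = k ℕ.* a ^ gap N ℕ.+ 1 , (begin
      (S N + s (suc N)) * A (P (suc N))                 ≡⟨ *-distribʳ-+ (A (P (suc N))) (S N) (s (suc N)) ⟩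
      S N * A (P (suc N)) + s (suc N) * A (P (suc N))   ≡⟨ cong₂ _+_ (cong (λ e → S N * A e) (sym P[N+1]≡)) (*-comm (s (suc N)) (A (P (suc N)))) ⟩
      S N * A (gap N ℕ.+ P N) + A (P (suc N)) * s (suc N) ≡⟨ cong₂ _+_ (cong (S N *_) (A-+ (gap N) (P N))) (A*u (P (suc N))) ⟩
      S N * (A (gap N) * A (P N)) + 1ℚ                  ≡⟨ cong (_+ 1ℚ) (solve 3 (λ x y z → x :* (y :* z) := x :* z :* y) refl (S N) (A (gap N)) (A (P N))) ⟩
      S N * A (P N) * A (gap N) + 1ℚ                    ≡⟨ cong (λ e → e * A (gap N) + 1ℚ) Sₙaᴾ≡k ⟩
      nat k * A (gap N) + nat 1                         ≡⟨ cong (_+ nat 1) (sym (nat-* k (a ^ gap N))) ⟩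
      nat (k ℕ.* a ^ gap N) + nat 1                     ≡⟨ sym (nat-+ (k ℕ.* a ^ gap N) 1) ⟩
      nat (k ℕ.* a ^ gap N ℕ.+ 1)                       ∎)
    where
    open ≡-Reasoning
    P[N+1]≡ : gap N ℕ.+ P N ≡ P (suc N)
    P[N+1]≡ = ℕP.m∸n+n≡m (ℕP.<⇒≤ (P-inc N))

  tail-lower : ∀ {r} → ConvergesTo S r → ∀ N → s (suc N) ≤ r - S N
  tail-lower {r} S→r N = subst (_≤ r - S N) (solve 2 (λ x y → x :+ y :- x := y) refl (S N) (s (suc N)))
                           (+-monoˡ-≤ (- S N) (limit-≥ (suc N) S→r (λ n → S-mono)))

  tail-upper : ∀ {r} → ConvergesTo S r → ∀ N → r - S N ≤ nat 2 * s (suc N)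
  tail-upper {r} S→r N = subst (r - S N ≤_) (solve 2 (λ x y → x :+ y :+ y :- x := con (nat 2) :* y) refl (S N) (s (suc N)))
                           (+-monoˡ-≤ (- S N) (limit-≤ (suc N) S→r (λ n N+1≤n → <⇒≤ (S<Q N+1≤n))))

  -- Liouville's argument. Suppose S → r = z/q and let k = S N · a^(P N). Then
  -- the integer z a^(P N) - k q equals (r - S N) a^(P N) q, which the tail
  -- bounds place strictly between 0 and 2 q a^(-gap N) ≤ 1 once gap N ≥ 2q.
  irrational : (∀ K → ∃ λ N → K ℕ.≤ gap N) → ∀ r → ¬ ConvergesTo S r
  irrational gaps-unbounded r S→r with gaps-unbounded (2 ℕ.* ↧ₙ r)
  ... | N , 2q≤gap with S-integral N
  ... | k , Sₙaᴾ≡k = no-integer-in-unit-interval T 0<T T<1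
    where
    q = ↧ₙ r
    F = A (P N) * nat q
    T = ↥ r ℤ.* + (a ^ P N) ℤ.- + (k ℕ.* q)

    F-nonNeg : NonNegative F
    F-nonNeg = nonNegative (≤-trans (≤-reflexive (sym (*-zeroˡ (nat q))))
                 (*-monoʳ-≤-nonNeg (nat q) {{nat-nonNeg q}} (nat-≤ (z≤n {a ^ P N}))))

    T≡ : (r - S N) * F ≡ int T
    T≡ = begin
      (r - S N) * (A (P N) * nat q)                   ≡⟨ solve 4 (λ r S A Q → (r :- S) :* (A :* Q) := (r :* Q) :* A :- (S :* A) :* Q) refl r (S N) (A (P N)) (nat q) ⟩
      (r * nat q) * A (P N) - (S N * A (P N)) * nat q ≡⟨ cong₂ (λ x y → x * A (P N) - y * nat q) (clear-denominator r) Sₙaᴾ≡k ⟩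
      int (↥ r) * A (P N) - nat k * nat q             ≡⟨ cong₂ (λ x y → x - y) (sym (int-* (↥ r) (+ (a ^ P N)))) (sym (nat-* k q)) ⟩
      int (↥ r ℤ.* + (a ^ P N)) - nat (k ℕ.* q)       ≡⟨ sym (int-sub (↥ r ℤ.* + (a ^ P N)) (+ (k ℕ.* q))) ⟩
      int T                                           ∎
      where open ≡-Reasoning

    0<T : 0ℚ < int T
    0<T = begin-strict
      0ℚ                ≡⟨ sym (*-zeroˡ F) ⟩
      0ℚ * F            <⟨ *-monoˡ-<-pos F {{F-pos}} (u-pos (P (suc N))) ⟩
      s (suc N) * F     ≤⟨ *-monoʳ-≤-nonNeg F {{F-nonNeg}} (tail-lower S→r N) ⟩
      (r - S N) * F     ≡⟨ T≡ ⟩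
      int T             ∎
      where
      open ≤-Reasoning
      F-pos : Positive F
      F-pos = pos*pos⇒pos (A (P N)) {{positive (nat-< (ℕP.m^n>0 a (P N)))}} (nat q) {{positive (nat-< {0} {q} (s≤s z≤n))}}

    T<1 : int T < 1ℚ
    T<1 = begin-strict
      int T                                   ≡⟨ sym T≡ ⟩
      (r - S N) * F                           ≤⟨ *-monoʳ-≤-nonNeg F {{F-nonNeg}} (tail-upper S→r N) ⟩
      nat 2 * s (suc N) * (A (P N) * nat q)   ≡⟨ solve 4 (λ t x A Q → t :* x :* (A :* Q) := (t :* Q) :* (x :* A)) refl (nat 2) (s (suc N)) (A (P N)) (nat q) ⟩
      (nat 2 * nat q) * (s (suc N) * A (P N)) ≡⟨ cong₂ _*_ (sym (nat-* 2 q)) (ratio≡ N) ⟩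
      nat (2 ℕ.* q) * u (gap N)               <⟨ u-small (2 ℕ.* q) (gap N) 2q≤gap ⟩
      1ℚ                                      ∎
      where open ≤-Reasoning

-- Exponents in arithmetic progression, P (n+1) = B + P n with B ≥ 1: then
-- Σ a^(-P(n)) is a geometric series, whose sum a^(-P(0)) / (a^B - 1) is rational
-- and whose ratio of consecutive terms is the constant a^(-B).
module ArithmeticExponents (a : ℕ) (h : 2 ℕ.≤ a) (P : ℕ → ℕ) (B : ℕ) (1≤B : 1 ℕ.≤ B)
                           (P-step : ∀ n → P (suc n) ≡ B ℕ.+ P n) where
  open Powers a h

  P-inc : ∀ n → P n ℕ.< P (suc n)
  P-inc n = ℕP.≤-trans (ℕP.+-monoˡ-≤ (P n) 1≤B) (ℕP.≤-reflexive (sym (P-step n)))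

  open IncreasingExponents a h P P-inc

  ratio-constant : ∀ n → s (suc n) * A (P n) ≡ u B
  ratio-constant n = trans (ratio≡ n) (cong u (trans (cong (ℕ._∸ P n) (P-step n)) (ℕP.m+n∸n≡m B (P n))))

  d : ℕ
  d = a ^ B ℕ.∸ 1

  1≤d : 1 ℕ.≤ d
  1≤d = ℕP.∸-monoˡ-≤ 1 (ℕP.≤-trans h (ℕP.≤-trans (ℕP.≤-reflexive (sym (ℕP.*-identityʳ a))) (ℕP.^-monoʳ-≤ a 1≤B)))

  instance
    d≢0 : ℕ.NonZero d
    d≢0 = ℕ.>-nonZero 1≤d

  v : ℚ
  v = + 1 / d

  v-nonNeg : NonNegative v
  v-nonNeg = nonNegative (<⇒≤ (recip-pos d))

  v≤1 : v ≤ 1ℚ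
  v≤1 = begin
      v            ≡⟨ sym (*-identityˡ v) ⟩
      1ℚ * v       ≤⟨ *-monoʳ-≤-nonNeg v {{v-nonNeg}} (nat-≤ 1≤d) ⟩
      nat d * v    ≡⟨ nat-inverse d ⟩
      1ℚ           ∎
    where open ≤-Reasoning

  geometric-step : u B * (1ℚ + v) ≡ v
  geometric-step = begin
      u B * (1ℚ + v)           ≡⟨ cong (λ x → u B * (x + v)) (sym (nat-inverse d)) ⟩
      u B * (nat d * v + v)    ≡⟨ solve 3 (λ x D y → x :* (D :* y :+ y) := x :* (D :+ con 1ℚ) :* y) refl (u B) (nat d) v ⟩
      u B * (nat d + 1ℚ) * v   ≡⟨ cong (λ x → u B * x * v) (sym aᴮ≡d+1) ⟩
      u B * A B * v            ≡⟨ cong (_* v) (trans (*-comm (u B) (A B)) (A*u B)) ⟩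
      1ℚ * v                   ≡⟨ *-identityˡ v ⟩
      v                        ∎
    where
    open ≡-Reasoning
    aᴮ≡d+1 : A B ≡ nat d + 1ℚ
    aᴮ≡d+1 = trans (cong nat (sym (ℕP.m∸n+n≡m (ℕP.m^n>0 a B)))) (nat-+ d 1)

  limit : ℚ
  limit = s 0 * v

  partial+tail : ∀ N → S N + s N * v ≡ limit
  partial+tail zero    = +-identityˡ (s 0 * v)
  partial+tail (suc N) = trans step (partial+tail N)
    where
    open ≡-Reasoning
    step : S N + s (suc N) + s (suc N) * v ≡ S N + s N * v
    step = begin
      S N + s (suc N) + s (suc N) * v       ≡⟨ solve 3 (λ S x v → S :+ x :+ x :* v := S :+ x :* (con 1ℚ :+ v)) refl (S N) (s (suc N)) v ⟩
      S N + s (suc N) * (1ℚ + v)            ≡⟨ cong (λ x → S N + x * (1ℚ + v)) (trans (cong u (P-step N)) (u-+ B (P N))) ⟩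
      S N + u B * s N * (1ℚ + v)            ≡⟨ cong (λ x → S N + x) (solve 3 (λ x y w → x :* y :* w := y :* (x :* w)) refl (u B) (s N) (1ℚ + v)) ⟩
      S N + s N * (u B * (1ℚ + v))          ≡⟨ cong (λ x → S N + s N * x) geometric-step ⟩
      S N + s N * v                         ∎

  -- The distance to the limit is the tail s N · v ≤ s N ≤ a^(-N).
  converges : ConvergesTo S limit
  converges ε 0<ε = ↧ₙ ε , λ N q≤N → ≤-<-trans (distance≤ N) (u→0 ε 0<ε (P N) (ℕP.≤-trans q≤N (n≤P N)))
    where
    distance≤ : ∀ N → ∣ S N - limit ∣ ≤ s N
    distance≤ N = begin
      ∣ S N - limit ∣               ≡⟨ cong (λ x → ∣ S N - x ∣) (sym (partial+tail N)) ⟩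
      ∣ S N - (S N + s N * v) ∣     ≡⟨ cong ∣_∣ (solve 2 (λ S w → S :- (S :+ w) := :- w) refl (S N) (s N * v)) ⟩
      ∣ - (s N * v) ∣               ≡⟨ ∣-p∣≡∣p∣ (s N * v) ⟩
      ∣ s N * v ∣                   ≡⟨ 0≤p⇒∣p∣≡p (nonNegative⁻¹ (s N * v) {{nonNeg*nonNeg⇒nonNeg (s N) {{u-nonNeg (P N)}} v {{v-nonNeg}}}}) ⟩
      s N * v                       ≤⟨ *-monoˡ-≤-nonNeg (s N) {{u-nonNeg (P N)}} v≤1 ⟩
      s N * 1ℚ                      ≡⟨ *-identityʳ (s N) ⟩
      s N                           ∎
      where open ≤-Reasoning

ΣFin-mono : ∀ k {f g : Fin k → ℕ} → (∀ i → f i ℕ.≤ g i) → ΣFin k f ℕ.≤ ΣFin k g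
ΣFin-mono zero    f≤g = z≤n
ΣFin-mono (suc k) f≤g = ℕP.+-mono-≤ (f≤g fzero) (ΣFin-mono k (λ i → f≤g (fsuc i)))

-- For exponent j + 2, consecutive powers differ by more than the base:
-- (n+1)^(j+2) = (n+1)^(j+1) + n (n+1)^(j+1) ≥ (n+1) + n^(j+2).
power-gap : ∀ n j → n ^ (2 ℕ.+ j) ℕ.+ suc n ℕ.≤ suc n ^ (2 ℕ.+ j)
power-gap n j = begin
    n ^ (2 ℕ.+ j) ℕ.+ suc n                      ≤⟨ ℕP.+-mono-≤ (ℕP.*-monoʳ-≤ n (ℕP.^-monoˡ-≤ (suc j) (ℕP.n≤1+n n))) sn≤sn^ ⟩
    n ℕ.* suc n ^ suc j ℕ.+ suc n ^ suc j        ≡⟨ ℕP.+-comm (n ℕ.* suc n ^ suc j) (suc n ^ suc j) ⟩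
    suc n ^ (2 ℕ.+ j)                            ∎
  where
  open ℕP.≤-Reasoning
  sn≤sn^ : suc n ℕ.≤ suc n ^ suc j
  sn≤sn^ = ℕP.m≤m*n (suc n) (suc n ^ j) {{ℕP.m^n≢0 (suc n) j}}

leading-gap : ∀ b n j → 1 ℕ.≤ b → b ℕ.* n ^ (2 ℕ.+ j) ℕ.+ suc n ℕ.≤ b ℕ.* suc n ^ (2 ℕ.+ j)
leading-gap b n j 1≤b = begin
    b ℕ.* n ^ (2 ℕ.+ j) ℕ.+ suc n                ≤⟨ ℕP.+-monoʳ-≤ (b ℕ.* n ^ (2 ℕ.+ j)) (ℕP.m≤n*m (suc n) b {{ℕ.>-nonZero 1≤b}}) ⟩
    b ℕ.* n ^ (2 ℕ.+ j) ℕ.+ b ℕ.* suc n          ≡⟨ sym (ℕP.*-distribˡ-+ b (n ^ (2 ℕ.+ j)) (suc n)) ⟩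
    b ℕ.* (n ^ (2 ℕ.+ j) ℕ.+ suc n)              ≤⟨ ℕP.*-monoʳ-≤ b (power-gap n j) ⟩
    b ℕ.* suc n ^ (2 ℕ.+ j)                      ∎
  where open ℕP.≤-Reasoning

poly-gap : ∀ j (b : Fin (3 ℕ.+ j) → ℕ) → 1 ℕ.≤ b fzero →
           ∀ n → poly (2 ℕ.+ j) b n ℕ.+ suc n ℕ.≤ poly (2 ℕ.+ j) b (suc n)
poly-gap j b 1≤b₀ n = begin
    (lead n ℕ.+ rest n) ℕ.+ suc n     ≡⟨ ℕP.+-assoc (lead n) (rest n) (suc n) ⟩
    lead n ℕ.+ (rest n ℕ.+ suc n)     ≡⟨ cong (lead n ℕ.+_) (ℕP.+-comm (rest n) (suc n)) ⟩
    lead n ℕ.+ (suc n ℕ.+ rest n)     ≡⟨ sym (ℕP.+-assoc (lead n) (suc n) (rest n)) ⟩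
    (lead n ℕ.+ suc n) ℕ.+ rest n     ≤⟨ ℕP.+-mono-≤ (leading-gap (b fzero) n j 1≤b₀) rest-mono ⟩
    lead (suc n) ℕ.+ rest (suc n)     ∎
  where
  open ℕP.≤-Reasoning
  m = 2 ℕ.+ j
  lead rest : ℕ → ℕ
  lead x = b fzero ℕ.* x ^ m
  rest x = ΣFin m (λ i → b (fsuc i) ℕ.* x ^ (m ℕ.∸ suc (toℕ i)))
  rest-mono : rest n ℕ.≤ rest (suc n)
  rest-mono = ΣFin-mono m (λ i → ℕP.*-monoʳ-≤ (b (fsuc i)) (ℕP.^-monoˡ-≤ (m ℕ.∸ suc (toℕ i)) (ℕP.n≤1+n n)))

poly₁-step : ∀ (b : Fin 2 → ℕ) n → poly 1 b (suc n) ≡ b fzero ℕ.+ poly 1 b n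
poly₁-step b n = trans (cong (ℕ._+ c₀) (ℕP.*-suc (b fzero) (n ℕ.* 1))) (ℕP.+-assoc (b fzero) (b fzero ℕ.* (n ℕ.* 1)) c₀)
  where c₀ = b (fsuc fzero) ℕ.* 1 ℕ.+ 0

-- Degree 0: all terms equal a^(-b₀); the series diverges and the ratio is 1.
-- Degree 1: geometric series with rational sum and constant ratio a^(-b₀).
-- Degree ≥ 2: the gaps P(n+1) - P(n) exceed n, so the ratio tends to 0 and
-- the sum is irrational.
theorem5 : (a : ℕ) (h : 2 ℕ.≤ a) (m : ℕ) (b : Fin (suc m) → ℕ) →
           (∀ i → 1 ℕ.≤ b i) →
           ConvergesToIrrational (partialSum (c a h m b)) ⇔ ConvergesTo (ratio a h m b) 0ℚ
theorem5 a h zero b _ =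
  mk⇔ (λ irr → ⊥-elim (constant-series-not-Cauchy (u-pos K) (λ _ → refl) (proj₁ irr)))
      (λ ratio→0 → ⊥-elim (constant-not-to-0 (nat-< {0} {1} (s≤s z≤n)) (λ _ → trans (*-comm (u K) (A K)) (A*u K)) ratio→0))
  where
  open Powers a h
  K = poly 0 b 0
theorem5 a h (suc zero) b pos =
  mk⇔ (λ irr → ⊥-elim (proj₂ irr limit converges))
      (λ ratio→0 → ⊥-elim (constant-not-to-0 (u-pos (b fzero)) ratio-constant ratio→0))
  where
  open Powers a h
  open ArithmeticExponents a h (poly 1 b) (b fzero) (pos fzero) (poly₁-step b)
theorem5 a h (suc (suc j)) b pos =
  mk⇔ (λ _ → ratio→0 (λ K → K , λ n K≤n → ℕP.≤-trans K≤n (n≤gap n)))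
      (λ _ → cauchy , irrational (λ K → K , n≤gap K))
  where
  P = poly (2 ℕ.+ j) b
  grows : ∀ n → P n ℕ.+ suc n ℕ.≤ P (suc n)
  grows = poly-gap j b (pos fzero)
  P-inc : ∀ n → P n ℕ.< P (suc n)
  P-inc n = ℕP.<-≤-trans (ℕP.m<m+n (P n) (s≤s z≤n)) (grows n)
  open IncreasingExponents a h P P-inc
  n≤gap : ∀ n → n ℕ.≤ gap n
  n≤gap n = ℕP.≤-trans (ℕP.n≤1+n n)
              (subst (ℕ._≤ gap n) (ℕP.m+n∸m≡n (P n) (suc n)) (ℕP.∸-monoˡ-≤ (P n) (grows n)))
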